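{- Let $G=(X\cup Y,E)$ be the complement of a bipartite graph (with bipartition $X,Y$, so that $X$ and $Y$ are cliques in $G$), and let $D(G)=k$. Then there exists an upper domatic partition $\pi=\{V_1,\dots,V_k\}$ of $G$ such that $\pi$ contains a source set.
   Context: All graphs are finite and simple. For disjoint vertex sets $A,B$, $A$ dominates $B$ if every vertex of $B$ is adjacent to at least one vertex of $A$. An upper domatic partition of size $k$ is a partition of $V(G)$ into $k$ nonempty parts $V_1,\dots,V_k$ such that for all $i\neq j$, $V_i$ dominates $V_j$ or $V_j$ dominates $V_i$ (or both); $D(G)$ is the maximum such $k$. A part $V_i$ of a partition $\{V_1,\dots,V_k\}$ is a source set if $V_i$ dominates every other part $V_j$, $j\ne i$. -}

module Defs where

open import Data.Nat using (ℕ; suc; _≤_)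
open import Data.Fin using (Fin)
open import Data.Bool using (Bool)
open import Data.Product using (Σ; ∃; _×_; _,_)
open import Data.Sum using (_⊎_)
open import Relation.Nullary using (¬_)
open import Relation.Binary.PropositionalEquality using (_≡_; _≢_)

record Graph (n : ℕ) : Set₁ where
  field
    Adj    : Fin n → Fin n → Set
    sym    : ∀ {u v} → Adj u v → Adj v u
    irrefl : ∀ {u} → ¬ Adj u u
open Graph public

-- G is the complement of a bipartite graph with bipartition X (side true),
-- Y (side false): any two distinct vertices on the same side are adjacent,
-- i.e. X and Y are cliques in G.
IsCoBipartite : ∀ {n} → Graph n → Set
IsCoBipartite {n} G =
  Σ (Fin n → Bool) λ side →
    ∀ u v → u ≢ v → side u ≡ side v → Adj G u v

-- A partition of V(G) into k parts, given by the part-assignment map p;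
-- parts are nonempty iff p is surjective.
Nonempty-parts : ∀ {n k} → (Fin n → Fin k) → Set
Nonempty-parts {n} {k} p = ∀ (i : Fin k) → ∃ λ (v : Fin n) → p v ≡ i

Dominates : ∀ {n k} → Graph n → (Fin n → Fin k) → Fin k → Fin k → Set
Dominates {n} G p i j =
  ∀ (v : Fin n) → p v ≡ j → ∃ λ (u : Fin n) → p u ≡ i × Adj G u v

IsUpperDomatic : ∀ {n k} → Graph n → (Fin n → Fin k) → Set
IsUpperDomatic {n} {k} G p =
  Nonempty-parts p ×
  (∀ (i j : Fin k) → i ≢ j → Dominates G p i j ⊎ Dominates G p j i)

UpperDomaticNumber : ∀ {n} → Graph n → ℕ → Set
UpperDomaticNumber {n} G k =
  (∃ λ (p : Fin n → Fin k) → IsUpperDomatic G p) ×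
  (∀ (m : ℕ) (q : Fin n → Fin m) → IsUpperDomatic G q → m ≤ k)

IsSourceSet : ∀ {n k} → Graph n → (Fin n → Fin k) → Fin k → Set
IsSourceSet {n} {k} G p i = ∀ (j : Fin k) → j ≢ i → Dominates G p i j

HasSourceSet : ∀ {n k} → Graph n → (Fin n → Fin k) → Set
HasSourceSet {n} {k} G p = ∃ λ (i : Fin k) → IsSourceSet G p i

{-# OPTIONS --safe #-}
module Submission where

-- Since X and Y are cliques, a part meeting both X and Y dominates every other
-- part. If no part is mixed but each of X and Y has two vertices sharing a part,
-- exchanging one vertex of each such pair makes both of these parts mixed and
-- leaves all other parts alone. Otherwise the parts meeting one side, say Y, are
-- singletons, and the part of any w ∈ X is a source: it dominates X ∖ {w}
-- through w, and a part {y} ⊆ Y that it does not dominate must dominate it,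
-- i.e. y is adjacent to w.

open import Defs hiding (sym)
open import Data.Nat using (ℕ; suc)
open import Data.Fin using (Fin; zero)
open import Data.Fin.Properties using (_≟_; any?)
open import Data.Fin.Permutation.Components using (transpose; transpose-inverse)
open import Data.Bool using (Bool; true; false; not)
open import Data.Bool.Properties using (not-¬; ¬-not; not-involutive) renaming (_≟_ to _≟ᵇ_)
open import Data.Product using (∃; ∃₂; _×_; _,_; proj₁; proj₂)
open import Data.Sum using (_⊎_; inj₁; inj₂) renaming (map to ⊎-map)
open import Function using (_∘_)
open import Relation.Nullary using (¬_; yes; no; contradiction)
open import Relation.Nullary.Decidable using (¬?; _×-dec_; dec-true; dec-false; decidable-stable)
open import Relation.Binary.PropositionalEquality using (_≡_; _≢_; refl; sym; trans; cong; subst)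

transpose-matchˡ : ∀ {n} (i j : Fin n) → transpose i j i ≡ j
transpose-matchˡ i j rewrite dec-true (i ≟ i) refl = refl

transpose-matchʳ : ∀ {n} (i j : Fin n) → transpose i j j ≡ i
transpose-matchʳ i j with j ≟ i
... | yes refl = refl
... | no _ rewrite dec-true (j ≟ j) refl = refl

transpose-mismatch : ∀ {n} {i j k : Fin n} → k ≢ i → k ≢ j → transpose i j k ≡ k
transpose-mismatch {i = i} {j} {k} k≢i k≢j
  rewrite dec-false (k ≟ i) k≢i | dec-false (k ≟ j) k≢j = refl

both-≢⇒≡ : ∀ {x y z : Bool} → x ≢ z → y ≢ z → x ≡ y
both-≢⇒≡ x≢z y≢z = trans (¬-not x≢z) (sym (¬-not y≢z))

UpperDomaticWithSource : ∀ {n} → Graph n → ℕ → Set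
UpperDomaticWithSource {n} G k =
  ∃ λ (p : Fin n → Fin k) → IsUpperDomatic G p × HasSourceSet G p

Nonempty-parts-∘-transpose : ∀ {n k} {p : Fin n → Fin k} (x y : Fin n) →
                             Nonempty-parts p → Nonempty-parts (p ∘ transpose x y)
Nonempty-parts-∘-transpose {p = p} x y nonempty i with nonempty i
... | v , pv≡i = transpose y x v , trans (cong p (transpose-inverse x y)) pv≡i

parts-≢ : ∀ {n k} (p : Fin n → Fin k) {u v : Fin n} {l m : Fin k} →
          p u ≡ l → p v ≡ m → m ≢ l → p u ≢ p v
parts-≢ _ pu≡l pv≡m m≢l pu≡pv = m≢l (trans (sym pv≡m) (trans (sym pu≡pv) pu≡l))

Dominates-mono : ∀ {n k} (G : Graph n) {p q : Fin n → Fin k} {l m : Fin k} →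
                 (∀ u → p u ≡ l → q u ≡ l) → (∀ v → q v ≡ m → p v ≡ m) →
                 Dominates G p l m → Dominates G q l m
Dominates-mono G grow shrink dom v qv≡m with dom v (shrink v qv≡m)
... | u , pu≡l , adj = u , grow u pu≡l , adj

module CoBipartite {n} (G : Graph n) (side : Fin n → Bool)
                   (clique : ∀ u v → u ≢ v → side u ≡ side v → Adj G u v) where

  adjacent : ∀ {k} (p : Fin n → Fin k) {u v} → p u ≢ p v → side u ≡ side v → Adj G u v
  adjacent p pu≢pv = clique _ _ (pu≢pv ∘ cong p)


  mixed-part-isSource : ∀ {k} (p : Fin n → Fin k) {l x y} →
                        p x ≡ l → p y ≡ l → side x ≢ side y → IsSourceSet G p l
  mixed-part-isSource p {x = x} {y} px≡l py≡l sx≢sy m m≢l v pv≡m with side x ≟ᵇ side v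
  ... | yes sx≡sv = x , px≡l , adjacent p (parts-≢ p px≡l pv≡m m≢l) sx≡sv
  ... | no sx≢sv  = y , py≡l , adjacent p (parts-≢ p py≡l pv≡m m≢l)
                                         (both-≢⇒≡ (sx≢sy ∘ sym) (sx≢sv ∘ sym))

  MixedPart : ∀ {k} → (Fin n → Fin k) → Set
  MixedPart p = ∃₂ λ x y → p x ≡ p y × side x ≢ side y

  InjectiveOn : ∀ {k} → (Fin n → Fin k) → Bool → Set
  InjectiveOn p b = ∀ u v → side u ≡ b → side v ≡ b → p u ≡ p v → u ≡ v

  Collision : ∀ {k} → (Fin n → Fin k) → Bool → Set
  Collision p b = ∃₂ λ u v → u ≢ v × p u ≡ p v × side u ≡ b × side v ≡ b

  injectiveOn⊎collision : ∀ {k} (p : Fin n → Fin k) b → InjectiveOn p b ⊎ Collision p b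
  injectiveOn⊎collision p b
    with any? (λ u → any? (λ v → ¬? (u ≟ v) ×-dec p u ≟ p v ×-dec side u ≟ᵇ b ×-dec side v ≟ᵇ b))
  ... | yes collision = inj₂ collision
  ... | no ¬collision = inj₁ injective
    where
      injective : InjectiveOn p b
      injective u v su sv pu≡pv with u ≟ v
      ... | yes u≡v = u≡v
      ... | no u≢v  = contradiction (u , v , u≢v , pu≡pv , su , sv) ¬collision

  unmixed-sameSide : ∀ {k} {p : Fin n → Fin k} → ¬ MixedPart p →
                     ∀ {u v} → p u ≡ p v → side u ≡ side v
  unmixed-sameSide unmixed {u} {v} pu≡pv =
    decidable-stable (side u ≟ᵇ side v) (λ su≢sv → unmixed (u , v , pu≡pv , su≢sv))

  injectiveOpposite-isSource : ∀ {k} {p : Fin n → Fin k} → IsUpperDomatic G p →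
                               ¬ MixedPart p → ∀ w → InjectiveOn p (not (side w)) →
                               IsSourceSet G p (p w)
  injectiveOpposite-isSource {p = p} ud unmixed w injective m m≢pw v pv≡m
    with side w ≟ᵇ side v
  ... | yes sw≡sv = w , refl , adjacent p (parts-≢ p refl pv≡m m≢pw) sw≡sv
  ... | no sw≢sv with proj₂ ud (p w) m (m≢pw ∘ sym)
  ...   | inj₁ dom = dom v pv≡m
  ...   | inj₂ dom with dom w refl
  ...     | u , pu≡m , adj-uw = w , refl , Graph.sym G (subst (λ x → Adj G x w) u≡v adj-uw)
    where
      sv : side v ≡ not (side w)
      sv = ¬-not (sw≢sv ∘ sym)
      u≡v : u ≡ v
      u≡v = injective u v (trans (unmixed-sameSide unmixed (trans pu≡m (sym pv≡m))) sv) sv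
                      (trans pu≡m (sym pv≡m))

  injectiveOn-opposite : ∀ {k} {p : Fin n → Fin k} {b} → Fin n → InjectiveOn p b →
                         ∃ λ w → InjectiveOn p (not (side w))
  injectiveOn-opposite {p = p} {b} v₀ injective with any? (λ w → side w ≟ᵇ not b)
  ... | yes (w , sw≡¬b) =
    w , subst (InjectiveOn p) (sym (trans (cong not sw≡¬b) (not-involutive b))) injective
  ... | no none =
    v₀ , λ u _ su _ _ → contradiction su (not-¬ (both-≢⇒≡ (none ∘ (u ,_)) (none ∘ (v₀ ,_))))

  module Exchange {k} {p : Fin n → Fin k} (ud : IsUpperDomatic G p) {b}
                  {a a′ c c′} (a≢a′ : a ≢ a′) (pa≡pa′ : p a ≡ p a′)
                  (sa : side a ≡ b) (sa′ : side a′ ≡ b)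
                  (c≢c′ : c ≢ c′) (pc≡pc′ : p c ≡ p c′)
                  (sc : side c ≡ not b) (sc′ : side c′ ≡ not b) where

    i j : Fin k
    i = p a
    j = p c

    q : Fin n → Fin k
    q = p ∘ transpose a′ c

    sides-≢ : ∀ {u v} → side u ≡ b → side v ≡ not b → side u ≢ side v
    sides-≢ su sv su≡sv = not-¬ su (trans su≡sv sv)

    opposite-≢ : ∀ {u v} → side u ≡ b → side v ≡ not b → u ≢ v
    opposite-≢ su sv = sides-≢ su sv ∘ cong side

    qa≡i : q a ≡ i
    qa≡i = cong p (transpose-mismatch a≢a′ (opposite-≢ sa sc))

    qc≡i : q c ≡ i
    qc≡i = trans (cong p (transpose-matchʳ a′ c)) (sym pa≡pa′)

    qa′≡j : q a′ ≡ j
    qa′≡j = cong p (transpose-matchˡ a′ c)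

    qc′≡j : q c′ ≡ j
    qc′≡j = trans (cong p (transpose-mismatch (opposite-≢ sa′ sc′ ∘ sym) (c≢c′ ∘ sym)))
                  (sym pc≡pc′)

    i-isSource : IsSourceSet G q i
    i-isSource = mixed-part-isSource q qa≡i qc≡i (sides-≢ sa sc)

    j-isSource : IsSourceSet G q j
    j-isSource = mixed-part-isSource q qa′≡j qc′≡j (sides-≢ sa′ sc′)

    q≡p-outside : ∀ {v} → v ≢ a′ → v ≢ c → q v ≡ p v
    q≡p-outside v≢a′ v≢c = cong p (transpose-mismatch v≢a′ v≢c)

    p⇒q-outside : ∀ {l} → l ≢ i → l ≢ j → ∀ v → p v ≡ l → q v ≡ l
    p⇒q-outside l≢i l≢j v pv≡l = trans (q≡p-outside v≢a′ v≢c) pv≡l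
      where
        v≢a′ : v ≢ a′
        v≢a′ refl = l≢i (trans (sym pv≡l) (sym pa≡pa′))
        v≢c : v ≢ c
        v≢c refl = l≢j (sym pv≡l)

    q⇒p-outside : ∀ {l} → l ≢ i → l ≢ j → ∀ v → q v ≡ l → p v ≡ l
    q⇒p-outside l≢i l≢j v qv≡l = trans (sym (q≡p-outside v≢a′ v≢c)) qv≡l
      where
        v≢a′ : v ≢ a′
        v≢a′ refl = l≢j (trans (sym qv≡l) qa′≡j)
        v≢c : v ≢ c
        v≢c refl = l≢i (trans (sym qv≡l) qc≡i)

    Dominates-outside : ∀ {l m} → l ≢ i → l ≢ j → m ≢ i → m ≢ j →
                        Dominates G p l m → Dominates G q l m
    Dominates-outside l≢i l≢j m≢i m≢j =
      Dominates-mono G (p⇒q-outside l≢i l≢j) (q⇒p-outside m≢i m≢j)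

    comparable : ∀ l m → l ≢ m → Dominates G q l m ⊎ Dominates G q m l
    comparable l m l≢m with l ≟ i | l ≟ j | m ≟ i | m ≟ j
    ... | yes refl | _ | _ | _ = inj₁ (i-isSource m (l≢m ∘ sym))
    ... | _ | yes refl | _ | _ = inj₁ (j-isSource m (l≢m ∘ sym))
    ... | _ | _ | yes refl | _ = inj₂ (i-isSource l l≢m)
    ... | _ | _ | _ | yes refl = inj₂ (j-isSource l l≢m)
    ... | no l≢i | no l≢j | no m≢i | no m≢j =
      ⊎-map (Dominates-outside l≢i l≢j m≢i m≢j) (Dominates-outside m≢i m≢j l≢i l≢j)
            (proj₂ ud l m l≢m)

    withSource : UpperDomaticWithSource G k
    withSource = q , (Nonempty-parts-∘-transpose a′ c (proj₁ ud) , comparable) , i , i-isSource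

  collisions⇒withSource : ∀ {k} {p : Fin n → Fin k} {b} → IsUpperDomatic G p →
                          Collision p b → Collision p (not b) → UpperDomaticWithSource G k
  collisions⇒withSource ud (_ , _ , a≢a′ , pa≡pa′ , sa , sa′) (_ , _ , c≢c′ , pc≡pc′ , sc , sc′) =
    Exchange.withSource ud a≢a′ pa≡pa′ sa sa′ c≢c′ pc≡pc′ sc sc′

  unmixed-injectiveOn⇒withSource : ∀ {k} {p : Fin n → Fin k} {b} → Fin n →
                                   IsUpperDomatic G p → ¬ MixedPart p → InjectiveOn p b →
                                   UpperDomaticWithSource G k
  unmixed-injectiveOn⇒withSource {p = p} v₀ ud unmixed injective
    with injectiveOn-opposite v₀ injective
  ... | w , injective′ = p , ud , p w , injectiveOpposite-isSource ud unmixed w injective′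

  upperDomatic⇒withSource : ∀ {k} {p : Fin n → Fin k} → Fin n → IsUpperDomatic G p →
                            UpperDomaticWithSource G k
  upperDomatic⇒withSource {p = p} v₀ ud
    with any? (λ x → any? (λ y → p x ≟ p y ×-dec ¬? (side x ≟ᵇ side y)))
  ... | yes (x , y , px≡py , sx≢sy) = p , ud , p x , mixed-part-isSource p refl (sym px≡py) sx≢sy
  ... | no unmixed with injectiveOn⊎collision p true | injectiveOn⊎collision p false
  ...   | inj₂ collisionX | inj₂ collisionY = collisions⇒withSource ud collisionX collisionY
  ...   | inj₁ injective  | _               = unmixed-injectiveOn⇒withSource v₀ ud unmixed injective
  ...   | _               | inj₁ injective  = unmixed-injectiveOn⇒withSource v₀ ud unmixed injective

lemma6 : ∀ (n : ℕ) (G : Graph (suc n)) → IsCoBipartite G →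
           ∀ (k : ℕ) → UpperDomaticNumber G k →
           ∃ λ (p : Fin (suc n) → Fin k) → IsUpperDomatic G p × HasSourceSet G p
lemma6 n G (side , clique) k ((_ , ud) , _) =
  CoBipartite.upperDomatic⇒withSource G side clique zero ud
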